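{- Let $G$ be a finite digraph, $P$ a finite poset, $S$ a finite set and $k\ge 1$. Suppose there is a map $r:P\to 2^S$ such that for all $x,y\in P$, $x\le y$ if and only if $r(x)\subseteq r(y)$. If the $k$-walks of $G$ are $P$-colorable, then the $(k+1)$-walks of $G$ are $S$-colorable, where $S$ carries the trivial partial order (i.e. there is a map $c'$ from $(k+1)$-walks to $S$ with $c'(v_1\dots v_{k+1})\neq c'(v_2\dots v_{k+2})$ for every $(k+2)$-walk $(v_1\dots v_{k+2})$).
   Context: A digraph has finite vertex set and edges that are ordered pairs of distinct vertices; write $u\to v$ for an edge. A $k$-walk is a sequence $(v_1\dots v_k)$ with $v_1\to\dots\to v_k$. For a poset $Q$, a $Q$-coloring of the $k$-walks is a map $c$ from $k$-walks to $Q$ with $c(v_1\dots v_k)\not\le c(v_2\dots v_{k+1})$ for every $(k+1)$-walk $(v_1\dots v_{k+1})$. The trivial partial order on a set is equality. -}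

module Defs where

open import Data.Nat using (ℕ; zero; suc)
open import Data.Fin using (Fin; inject₁) renaming (suc to fsuc)
open import Data.Fin.Subset using (Subset; _⊆_)
open import Data.Product using (Σ; _×_; _,_; proj₁; proj₂)
open import Function using (_∘_; _⇔_)
open import Relation.Nullary using (¬_)
open import Relation.Binary using (Rel; IsPartialOrder)
open import Relation.Binary.PropositionalEquality using (_≡_)

record Digraph : Set₁ where
  field
    n      : ℕ
    _⇒_    : Fin n → Fin n → Set
    irrefl : ∀ v → ¬ (v ⇒ v)

open Digraph public

-- A k-walk (v₁ … v_k) for k ≥ 1, written with k = suc m as a sequence
-- v : Fin (suc m) → vertices with v i → v (i+1) for every i.
IsWalk : (G : Digraph) → ∀ {m} → (Fin (suc m) → Fin (n G)) → Set
IsWalk G {m} v = (i : Fin m) → _⇒_ G (v (inject₁ i)) (v (fsuc i))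

Walk : Digraph → ℕ → Set
Walk G m = Σ (Fin (suc m) → Fin (n G)) (IsWalk G)

initW : (G : Digraph) → ∀ {m} → Walk G (suc m) → Walk G m
initW G (v , p) = v ∘ inject₁ , p ∘ inject₁

tailW : (G : Digraph) → ∀ {m} → Walk G (suc m) → Walk G m
tailW G (v , p) = v ∘ fsuc , p ∘ fsuc

IsColoring : (G : Digraph) (m : ℕ) {Q : Set} (_≤_ : Rel Q _) → (Walk G m → Q) → Set
IsColoring G m _≤_ c = (w : Walk G (suc m)) → ¬ (c (initW G w) ≤ c (tailW G w))

Colorable : (G : Digraph) (m : ℕ) (Q : Set) (_≤_ : Rel Q _) → Set
Colorable G m Q _≤_ = Σ (Walk G m → Q) (IsColoring G m _≤_)

{-# OPTIONS --safe #-}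
module Submission where

open import Defs
open import Data.Nat using (ℕ; suc)
open import Data.Fin using (Fin)
open import Data.Fin.Properties using (¬∀⟶∃¬)
open import Data.Fin.Subset using (Subset; _⊆_; _⊈_; _∈_; _∉_)
open import Data.Fin.Subset.Properties using (_∈?_)
open import Data.Product using (Σ; ∃; _×_; _,_; proj₁; proj₂)
open import Function using (_∘_; _⇔_; const; Equivalence)
open import Relation.Binary using (Rel; IsPartialOrder)
open import Relation.Binary.PropositionalEquality using (_≡_; subst; sym)
open import Relation.Nullary using (yes; no; contradiction)
open import Relation.Nullary.Decidable using (_→-dec_)

-- Compose the P-coloring with r to get a coloring by subsets of S under ⊆.
-- A (k+1)-walk w then has c(init w) ⊈ c(tail w); colour it by a point
-- i(w) ∈ c(init w) ∖ c(tail w).  For a (k+2)-walk W the middle k-walk is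
-- both tail(init W) and init(tail W), so i(init W) lies outside it while
-- i(tail W) lies inside it: the two colours differ.  Only the direction
-- r x ⊆ r y → x ≤ y is needed, and no axiom of the partial order.

p⊈q⇒∃x∈p∧x∉q : ∀ {s} {p q : Subset s} → p ⊈ q → ∃ λ x → x ∈ p × x ∉ q
p⊈q⇒∃x∈p∧x∉q {s} {p} {q} p⊈q
  with ¬∀⟶∃¬ s (λ x → x ∈ p → x ∈ q) (λ x → x ∈? p →-dec x ∈? q) (λ p⊆q → p⊈q (p⊆q _))
... | x , x∈p⇏x∈q with x ∈? p
...   | yes x∈p = x , x∈p , x∈p⇏x∈q ∘ const
...   | no  x∉p = contradiction (λ x∈p → contradiction x∈p x∉p) x∈p⇏x∈q

module _ (G : Digraph) (m : ℕ) where

  colorable-reflect : ∀ {Q R : Set} {_≤Q_ : Rel Q _} {_≤R_ : Rel R _}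
    (f : Q → R) → (∀ {x y} → f x ≤R f y → x ≤Q y) →
    Colorable G m Q _≤Q_ → Colorable G m R _≤R_
  colorable-reflect f reflects (c , coloring) = f ∘ c , λ w → coloring w ∘ reflects

  subsetColorable⇒colorable-succ : ∀ {s} →
    Colorable G m (Subset s) _⊆_ → Colorable G (suc m) (Fin s) _≡_
  subsetColorable⇒colorable-succ {s} (c , coloring) = colour , isColoring
    where
    separator : (w : Walk G (suc m)) → ∃ λ x → x ∈ c (initW G w) × x ∉ c (tailW G w)
    separator w = p⊈q⇒∃x∈p∧x∉q (coloring w)

    colour : Walk G (suc m) → Fin s
    colour = proj₁ ∘ separator

    isColoring : IsColoring G (suc m) _≡_ colour
    isColoring w same = colour-init∉middle (subst (_∈ middle) (sym same) colour-tail∈middle)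
      where
      middle : Subset s
      middle = c (tailW G (initW G w))

      colour-init∉middle : colour (initW G w) ∉ middle
      colour-init∉middle = proj₂ (proj₂ (separator (initW G w)))

      colour-tail∈middle : colour (tailW G w) ∈ middle
      colour-tail∈middle = proj₁ (proj₂ (separator (tailW G w)))

mainTheorem7 : (G : Digraph) (p s m : ℕ) (_≤P_ : Rel (Fin p) _)
    → IsPartialOrder _≡_ _≤P_
    → Σ (Fin p → Subset s) (λ r → ∀ x y → (x ≤P y) ⇔ (r x ⊆ r y))
    → Colorable G m (Fin p) _≤P_
    → Colorable G (suc m) (Fin s) _≡_
mainTheorem7 G p s m _≤P_ _ (r , r-embedding) =
  subsetColorable⇒colorable-succ G m
  ∘ colorable-reflect G m {_≤R_ = _⊆_} r (Equivalence.from (r-embedding _ _))
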